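{- For integers $n\ge -1$ define $$aa(n)=(-1)^{n-1} q^{\binom{n}2}\left\{ \sum _{j=0}^{\lfloor\frac{n}2\rfloor}\sum_{i=-j+1}^j q^{j^2-i^2} + \sum _{j=0}^{\lfloor\frac{n-1}2\rfloor}\sum_{i=-j}^j q^{j^2+j-i^2-i} \right\},$$ and for integers $n\ge0$ let $aa1(n):=aa(n)+q^{n-1}aa(n-1)$. Then for all integers $n\geq0$, $$aa1(2n)=-q^{3n^2-n}\sum_{j=-n+1}^n q^{ -j^2}, \qquad aa1(2n+1)=q^{3n^2+2n}\sum_{j=-n}^n q^{ -j^2-j},$$ and $$aa(n)=\sum_{j=0}^n (-1)^jq^{nj-\binom{j+1}2}\, aa1(n-j).$$
   Context: $\binom{n}{2}=n(n-1)/2$ for all integers $n$. A sum whose upper limit is smaller than its lower limit is zero (so $aa(-1)=aa(0)=0$). -}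

module Defs where

open import Data.Nat as ℕ using (ℕ; zero; suc)
open import Data.Integer as ℤ using (ℤ; +_; -[1+_]; ∣_∣)
open import Data.Integer.DivMod using (_/ℕ_)
open import Algebra.Bundles using (CommutativeRing)

binom2 : ℤ → ℤ
binom2 n = (n ℤ.* (n ℤ.- ℤ.1ℤ)) /ℕ 2

-- floor(n/2) for integers n (Data.Integer.DivMod._/ℕ_ rounds towards -∞)
half : ℤ → ℤ
half n = n /ℕ 2

len : ℤ → ℤ → ℕ
len lo hi with hi ℤ.- lo ℤ.+ ℤ.1ℤ
... | + m = m
... | -[1+ _ ] = 0

module Q {c ℓ} (R : CommutativeRing c ℓ) (q q⁻ : CommutativeRing.Carrier R) where
  open CommutativeRing R

  pow : Carrier → ℕ → Carrier
  pow x zero = 1#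
  pow x (suc k) = x * pow x k

  -- integer powers of q, with q⁻ playing the role of q^{-1}
  qz : ℤ → Carrier
  qz (+ k) = pow q k
  qz -[1+ k ] = pow q⁻ (suc k)

  sgn : ℤ → Carrier
  sgn k = pow (- 1#) ∣ k ∣

  sumN : ℕ → (ℕ → Carrier) → Carrier
  sumN zero f = 0#
  sumN (suc m) f = sumN m f + f m

  sumZ : ℤ → ℤ → (ℤ → Carrier) → Carrier
  sumZ lo hi f = sumN (len lo hi) (λ k → f (lo ℤ.+ + k))

  aa : ℤ → Carrier
  aa n = sgn (n ℤ.- ℤ.1ℤ) * qz (binom2 n) *
    ( sumZ ℤ.0ℤ (half n) (λ j → sumZ (ℤ.- j ℤ.+ ℤ.1ℤ) j (λ i →
         qz (j ℤ.* j ℤ.- i ℤ.* i)))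
    + sumZ ℤ.0ℤ (half (n ℤ.- ℤ.1ℤ)) (λ j → sumZ (ℤ.- j) j (λ i →
         qz (j ℤ.* j ℤ.+ j ℤ.- i ℤ.* i ℤ.- i))) )

  aa1 : ℤ → Carrier
  aa1 n = aa n + qz (n ℤ.- ℤ.1ℤ) * aa (n ℤ.- ℤ.1ℤ)

-- For n = 2x the sign of aa n is −1, C(2x,2) = x(2x−1) and the two outer sums stop at x and x − 1;
-- for n = 2x+1 the sign is +1, C(2x+1,2) = x(2x+1) and both stop at x. In
-- aa1 n = aa n + q^(n−1) aa (n−1) the powers of q then agree, so everything cancels except the
-- last row of the longer outer sum, and that row factors as q^(x²) Σ q^(−i²), resp.
-- q^(x²+x) Σ q^(−i²−i). For the expansion, C(j+2,2) = C(j+1,2) + j + 1 makes the j-th summand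
-- equal to d j − d (j+1) with d j = (−1)^j q^(nj − C(j+1,2)) aa (n−j), so the sum telescopes to
-- d 0 − d (n+1) = aa n − 0, as aa (−1) = 0.

module Submission where

open import Data.Nat as ℕ using (ℕ; zero; suc; z≤n; s≤s)
open import Data.Integer as ℤ using (ℤ; +_; -[1+_]; ∣_∣; 0ℤ; 1ℤ; -1ℤ)
open import Data.Integer.DivMod using (_%ℕ_; a≡a%ℕn+[a/ℕn]*n; n%ℕd<d)
import Data.Integer.Properties as ℤP
import Data.Nat.Properties as ℕP
open import Data.Integer.Tactic.RingSolver using (solve-∀; solve)
open import Data.List using (_∷_; [])
open import Data.Product using (_×_; _,_)
open import Relation.Binary.PropositionalEquality as ≡ using (_≡_; cong; cong₂; subst; module ≡-Reasoning)
open import Algebra.Bundles using (CommutativeRing)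
open import Defs

∣r-s∣≤1 : ∀ {r s} → r ℕ.< 2 → s ℕ.< 2 → ∣ + r ℤ.- + s ∣ ℕ.≤ 1
∣r-s∣≤1 {0} {0} _ _ = z≤n
∣r-s∣≤1 {0} {1} _ _ = s≤s z≤n
∣r-s∣≤1 {1} {0} _ _ = s≤s z≤n
∣r-s∣≤1 {1} {1} _ _ = z≤n
∣r-s∣≤1 {suc (suc _)} (s≤s (s≤s ())) _
∣r-s∣≤1 {_} {suc (suc _)} _ (s≤s (s≤s ()))

m*2≤1⇒m≡0 : ∀ {m} → m ℕ.* 2 ℕ.≤ 1 → m ≡ 0
m*2≤1⇒m≡0 {zero} _ = ≡.refl
m*2≤1⇒m≡0 {suc m} (s≤s ())

half-unique : ∀ x y r → r ℕ.< 2 → x ≡ + r ℤ.+ y ℤ.* + 2 → half x ≡ y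
half-unique x y r r<2 x≡r+y*2 =
  ℤP.i-j≡0⇒i≡j _ _ (ℤP.∣i∣≡0⇒i≡0 (m*2≤1⇒m≡0 ∣half-y∣*2≤1))
  where
  open ≡-Reasoning
  s = x %ℕ 2
  shift : ∀ a b c d → (a ℤ.- b) ℤ.* + 2 ≡ (c ℤ.+ a ℤ.* + 2) ℤ.- (d ℤ.+ b ℤ.* + 2) ℤ.+ d ℤ.- c
  shift = solve-∀
  [half-y]*2 : (half x ℤ.- y) ℤ.* + 2 ≡ + r ℤ.- + s
  [half-y]*2 = begin
    (half x ℤ.- y) ℤ.* + 2
      ≡⟨ shift (half x) y (+ s) (+ r) ⟩
    (+ s ℤ.+ half x ℤ.* + 2) ℤ.- (+ r ℤ.+ y ℤ.* + 2) ℤ.+ + r ℤ.- + s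
      ≡⟨ cong (λ t → t ℤ.- (+ r ℤ.+ y ℤ.* + 2) ℤ.+ + r ℤ.- + s)
              (≡.trans (≡.sym (a≡a%ℕn+[a/ℕn]*n x 2)) x≡r+y*2) ⟩
    (+ r ℤ.+ y ℤ.* + 2) ℤ.- (+ r ℤ.+ y ℤ.* + 2) ℤ.+ + r ℤ.- + s
      ≡⟨ cong (λ t → t ℤ.+ + r ℤ.- + s) (ℤP.+-inverseʳ (+ r ℤ.+ y ℤ.* + 2)) ⟩
    + r ℤ.- + s
      ∎
  ∣half-y∣*2≤1 : ∣ half x ℤ.- y ∣ ℕ.* 2 ℕ.≤ 1
  ∣half-y∣*2≤1 = subst (ℕ._≤ 1)
    (≡.trans (cong ∣_∣ (≡.sym [half-y]*2)) (ℤP.abs-* (half x ℤ.- y) (+ 2)))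
    (∣r-s∣≤1 r<2 (n%ℕd<d x 2))

half[2x]≡x : ∀ x → half (+ 2 ℤ.* x) ≡ x
half[2x]≡x x = half-unique (+ 2 ℤ.* x) x 0 (s≤s z≤n) (solve (x ∷ []))

half[2x-1]≡x-1 : ∀ x → half (+ 2 ℤ.* x ℤ.- 1ℤ) ≡ x ℤ.- 1ℤ
half[2x-1]≡x-1 x = half-unique (+ 2 ℤ.* x ℤ.- 1ℤ) (x ℤ.- 1ℤ) 1 (s≤s (s≤s z≤n)) (solve (x ∷ []))

half[2x+1]≡x : ∀ x → half (+ 2 ℤ.* x ℤ.+ 1ℤ) ≡ x
half[2x+1]≡x x = half-unique (+ 2 ℤ.* x ℤ.+ 1ℤ) x 1 (s≤s (s≤s z≤n)) (solve (x ∷ []))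

binom2[2x]≡x[2x-1] : ∀ x → binom2 (+ 2 ℤ.* x) ≡ x ℤ.* (+ 2 ℤ.* x ℤ.- 1ℤ)
binom2[2x]≡x[2x-1] x =
  half-unique (+ 2 ℤ.* x ℤ.* (+ 2 ℤ.* x ℤ.- 1ℤ)) _ 0 (s≤s z≤n) (solve (x ∷ []))

binom2[2x+1]≡x[2x+1] : ∀ x → binom2 (+ 2 ℤ.* x ℤ.+ 1ℤ) ≡ x ℤ.* (+ 2 ℤ.* x ℤ.+ 1ℤ)
binom2[2x+1]≡x[2x+1] x =
  half-unique ((+ 2 ℤ.* x ℤ.+ 1ℤ) ℤ.* (+ 2 ℤ.* x ℤ.+ 1ℤ ℤ.- 1ℤ)) _ 0 (s≤s z≤n) (solve (x ∷ []))

binom2-suc : ∀ x → binom2 (x ℤ.+ 1ℤ) ≡ binom2 x ℤ.+ x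
binom2-suc x =
  half-unique ((x ℤ.+ 1ℤ) ℤ.* (x ℤ.+ 1ℤ ℤ.- 1ℤ)) (binom2 x ℤ.+ x) r (n%ℕd<d x[x-1] 2) (begin
  (x ℤ.+ 1ℤ) ℤ.* (x ℤ.+ 1ℤ ℤ.- 1ℤ)        ≡⟨ solve (x ∷ []) ⟩
  x ℤ.* (x ℤ.- 1ℤ) ℤ.+ x ℤ.* + 2          ≡⟨ cong (ℤ._+ x ℤ.* + 2) (a≡a%ℕn+[a/ℕn]*n x[x-1] 2) ⟩
  + r ℤ.+ binom2 x ℤ.* + 2 ℤ.+ x ℤ.* + 2   ≡⟨ regroup (+ r) (binom2 x) x ⟩
  + r ℤ.+ (binom2 x ℤ.+ x) ℤ.* + 2         ∎)
  where
  open ≡-Reasoning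
  x[x-1] = x ℤ.* (x ℤ.- 1ℤ)
  r = x[x-1] %ℕ 2
  regroup : ∀ a b c → a ℤ.+ b ℤ.* + 2 ℤ.+ c ℤ.* + 2 ≡ a ℤ.+ (b ℤ.+ c) ℤ.* + 2
  regroup = solve-∀

-- Written with 1ℤ ℤ.+ j because 1ℤ ℤ.+ + k reduces to + suc k.
expansion-exponent-suc : ∀ N j → N ℤ.* j ℤ.- binom2 (j ℤ.+ 1ℤ) ℤ.+ (N ℤ.- j ℤ.- 1ℤ)
                       ≡ N ℤ.* (1ℤ ℤ.+ j) ℤ.- binom2 (1ℤ ℤ.+ j ℤ.+ 1ℤ)
expansion-exponent-suc N j = begin
  N ℤ.* j ℤ.- binom2 (j ℤ.+ 1ℤ) ℤ.+ (N ℤ.- j ℤ.- 1ℤ)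
    ≡⟨ regroup N j (binom2 (j ℤ.+ 1ℤ)) ⟩
  N ℤ.* (1ℤ ℤ.+ j) ℤ.- (binom2 (j ℤ.+ 1ℤ) ℤ.+ (j ℤ.+ 1ℤ))
    ≡⟨ cong (λ b → N ℤ.* (1ℤ ℤ.+ j) ℤ.- b) (binom2-suc (j ℤ.+ 1ℤ)) ⟨
  N ℤ.* (1ℤ ℤ.+ j) ℤ.- binom2 (j ℤ.+ 1ℤ ℤ.+ 1ℤ)
    ≡⟨ cong (λ t → N ℤ.* (1ℤ ℤ.+ j) ℤ.- binom2 t) j+1+1≡1+j+1 ⟩
  N ℤ.* (1ℤ ℤ.+ j) ℤ.- binom2 (1ℤ ℤ.+ j ℤ.+ 1ℤ)
    ∎
  where
  open ≡-Reasoning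
  regroup : ∀ N j b →
    N ℤ.* j ℤ.- b ℤ.+ (N ℤ.- j ℤ.- 1ℤ) ≡ N ℤ.* (1ℤ ℤ.+ j) ℤ.- (b ℤ.+ (j ℤ.+ 1ℤ))
  regroup = solve-∀
  j+1+1≡1+j+1 : j ℤ.+ 1ℤ ℤ.+ 1ℤ ≡ 1ℤ ℤ.+ j ℤ.+ 1ℤ
  j+1+1≡1+j+1 = solve (j ∷ [])

len-≡ : ∀ lo hi {k} → hi ℤ.- lo ℤ.+ 1ℤ ≡ + k → len lo hi ≡ k
len-≡ lo hi eq with hi ℤ.- lo ℤ.+ 1ℤ | eq
... | + _ | ≡.refl = ≡.refl

module IntegerPowers {c ℓ} (R : CommutativeRing c ℓ) (u u⁻ : CommutativeRing.Carrier R)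
  (u*u⁻≈1 : CommutativeRing._≈_ R (CommutativeRing._*_ R u u⁻) (CommutativeRing.1# R)) where
  open CommutativeRing R
  open Q R u u⁻ public
  open import Algebra.Properties.Semiring.Exp semiring using (_^_; ^-homo-*)
  open import Algebra.Properties.CommutativeSemigroup *-commutativeSemigroup using (interchange)
  open import Relation.Binary.Reasoning.Setoid setoid

  pow≡^ : ∀ x n → pow x n ≡ x ^ n
  pow≡^ x zero = ≡.refl
  pow≡^ x (suc n) = cong (x *_) (pow≡^ x n)

  pow-+ : ∀ x m n → pow x (m ℕ.+ n) ≈ pow x m * pow x n
  pow-+ x m n = begin
    pow x (m ℕ.+ n)     ≡⟨ pow≡^ x (m ℕ.+ n) ⟩
    x ^ (m ℕ.+ n)       ≈⟨ ^-homo-* x m n ⟩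
    x ^ m * x ^ n       ≡⟨ ≡.sym (cong₂ _*_ (pow≡^ x m) (pow≡^ x n)) ⟩
    pow x m * pow x n   ∎

  qz-⊖ : ∀ m n → qz (m ℤ.⊖ n) ≈ pow u m * pow u⁻ n
  qz-⊖ m       zero    = sym (*-identityʳ _)
  qz-⊖ zero    (suc n) = sym (*-identityˡ _)
  qz-⊖ (suc m) (suc n) = begin
    qz (suc m ℤ.⊖ suc n)                  ≡⟨ cong qz (ℤP.[1+m]⊖[1+n]≡m⊖n m n) ⟩
    qz (m ℤ.⊖ n)                          ≈⟨ qz-⊖ m n ⟩
    pow u m * pow u⁻ n                    ≈⟨ *-identityˡ _ ⟨
    1# * (pow u m * pow u⁻ n)             ≈⟨ *-congʳ u*u⁻≈1 ⟨
    (u * u⁻) * (pow u m * pow u⁻ n)       ≈⟨ interchange u u⁻ (pow u m) (pow u⁻ n) ⟩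
    (u * pow u m) * (u⁻ * pow u⁻ n)       ∎

  qz-+ : ∀ a b → qz (a ℤ.+ b) ≈ qz a * qz b
  qz-+ (+ m)    (+ n)    = pow-+ u m n
  qz-+ (+ m)    -[1+ n ] = qz-⊖ m (suc n)
  qz-+ -[1+ m ] (+ n)    = trans (qz-⊖ n (suc m)) (*-comm _ _)
  qz-+ -[1+ m ] -[1+ n ] = begin
    pow u⁻ (suc (suc (m ℕ.+ n)))          ≡⟨ cong (pow u⁻) (≡.sym (ℕP.+-suc (suc m) n)) ⟩
    pow u⁻ (suc m ℕ.+ suc n)              ≈⟨ pow-+ u⁻ (suc m) (suc n) ⟩
    pow u⁻ (suc m) * pow u⁻ (suc n)       ∎

  qz-+-≡ : ∀ a b {c} → a ℤ.+ b ≡ c → qz a * qz b ≈ qz c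
  qz-+-≡ a b ≡.refl = sym (qz-+ a b)

  qz-merge : ∀ a b {c} → a ℤ.+ b ≡ c → ∀ y → qz a * (qz b * y) ≈ qz c * y
  qz-merge a b a+b≡c y = trans (sym (*-assoc (qz a) (qz b) y)) (*-congʳ (qz-+-≡ a b a+b≡c))

module Sums {c ℓ} (R : CommutativeRing c ℓ) (q q⁻ : CommutativeRing.Carrier R) where
  open CommutativeRing R
  open Q R q q⁻
  open import Relation.Binary.Reasoning.Setoid setoid

  sumN-cong : ∀ m {f g} → (∀ k → f k ≈ g k) → sumN m f ≈ sumN m g
  sumN-cong zero    f≈g = refl
  sumN-cong (suc m) f≈g = +-cong (sumN-cong m f≈g) (f≈g m)

  *-distribˡ-sumN : ∀ m x f → x * sumN m f ≈ sumN m (λ k → x * f k)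
  *-distribˡ-sumN zero    x f = zeroʳ x
  *-distribˡ-sumN (suc m) x f = trans (distribˡ x (sumN m f) (f m)) (+-congʳ (*-distribˡ-sumN m x f))

  sumN-telescope : ∀ m (d : ℕ → Carrier) → sumN m (λ k → d k - d (suc k)) ≈ d 0 - d m
  sumN-telescope zero    d = sym (-‿inverseʳ (d 0))
  sumN-telescope (suc m) d = begin
    sumN m (λ k → d k - d (suc k)) + (d m - d (suc m)) ≈⟨ +-congʳ (sumN-telescope m d) ⟩
    (d 0 - d m) + (d m - d (suc m))                    ≈⟨ +-assoc (d 0) (- d m) _ ⟩
    d 0 + (- d m + (d m - d (suc m)))                  ≈⟨ +-congˡ (+-assoc (- d m) (d m) _) ⟨
    d 0 + ((- d m + d m) - d (suc m))                  ≈⟨ +-congˡ (+-congʳ (-‿inverseˡ (d m))) ⟩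
    d 0 + (0# - d (suc m))                             ≈⟨ +-congˡ (+-identityˡ _) ⟩
    d 0 - d (suc m)                                    ∎

  sumZ-cong : ∀ lo hi {f g} → (∀ i → f i ≈ g i) → sumZ lo hi f ≈ sumZ lo hi g
  sumZ-cong lo hi f≈g = sumN-cong (len lo hi) (λ k → f≈g (lo ℤ.+ + k))

  *-distribˡ-sumZ : ∀ lo hi x f → x * sumZ lo hi f ≈ sumZ lo hi (λ i → x * f i)
  *-distribˡ-sumZ lo hi x f = *-distribˡ-sumN (len lo hi) x _

  sumZ-snoc : ∀ lo k f → sumZ lo (lo ℤ.+ + k) f ≈ sumZ lo (lo ℤ.+ + k ℤ.- 1ℤ) f + f (lo ℤ.+ + k)
  sumZ-snoc lo k f = begin
    sumN (len lo (lo ℤ.+ + k)) g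
      ≡⟨ cong (λ m → sumN m g) (len-≡ lo (lo ℤ.+ + k) (len-last lo (+ k))) ⟩
    sumN k g + g k
      ≡⟨ cong (λ m → sumN m g + g k) (len-≡ lo (lo ℤ.+ + k ℤ.- 1ℤ) (len-init lo (+ k))) ⟨
    sumN (len lo (lo ℤ.+ + k ℤ.- 1ℤ)) g + g k
      ∎
    where
    g = λ k → f (lo ℤ.+ + k)
    len-last : ∀ lo x → lo ℤ.+ x ℤ.- lo ℤ.+ 1ℤ ≡ 1ℤ ℤ.+ x
    len-last = solve-∀
    len-init : ∀ lo x → lo ℤ.+ x ℤ.- 1ℤ ℤ.- lo ℤ.+ 1ℤ ≡ x
    len-init = solve-∀

  sumZ-from-0 : ∀ n f → sumZ 0ℤ (+ n) f ≡ sumN (suc n) (λ k → f (+ k))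
  sumZ-from-0 n f = cong (λ m → sumN m (λ k → f (+ k))) (len-≡ 0ℤ (+ n) (len-from-0 (+ n)))
    where
    len-from-0 : ∀ x → x ℤ.- 0ℤ ℤ.+ 1ℤ ≡ 1ℤ ℤ.+ x
    len-from-0 = solve-∀

module Proof {c ℓ} (R : CommutativeRing c ℓ) (q q⁻ : CommutativeRing.Carrier R)
  (q*q⁻≈1 : CommutativeRing._≈_ R (CommutativeRing._*_ R q q⁻) (CommutativeRing.1# R)) where
  open CommutativeRing R
  open Sums R q q⁻
  open IntegerPowers R q q⁻ q*q⁻≈1
  open import Algebra.Properties.Ring ring
    using (-1*x≈-x; -‿involutive; -‿+-comm; xyx⁻¹≈y; -‿distribˡ-*; -‿distribʳ-*; -0#≈0#)
  open import Algebra.Properties.CommutativeSemigroup +-commutativeSemigroup using (xy∙z≈xz∙y)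
  open import Relation.Binary.Reasoning.Setoid setoid

  -[x+y]+x≈-y : ∀ x y → - (x + y) + x ≈ - y
  -[x+y]+x≈-y x y = begin
    - (x + y) + x        ≈⟨ +-congˡ (-‿involutive x) ⟨
    - (x + y) + - - x    ≈⟨ -‿+-comm (x + y) (- x) ⟩
    - (x + y + - x)      ≈⟨ -‿cong (xyx⁻¹≈y x y) ⟩
    - y                  ∎

  -1*-1≈1 : - 1# * - 1# ≈ 1#
  -1*-1≈1 = trans (-1*x≈-x (- 1#)) (-‿involutive 1#)

  module Sign = IntegerPowers R (- 1#) (- 1#) -1*-1≈1

  -- sgn k = (−1)^∣k∣ is the integer power of the self-inverse unit −1, so it obeys the exponent law.
  sgn≡Sign-qz : ∀ k → sgn k ≡ Sign.qz k
  sgn≡Sign-qz (+ n)    = ≡.trans (pow≡^ (- 1#) n) (≡.sym (Sign.pow≡^ (- 1#) n))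
  sgn≡Sign-qz -[1+ n ] = ≡.trans (pow≡^ (- 1#) (suc n)) (≡.sym (Sign.pow≡^ (- 1#) (suc n)))

  sgn-+ : ∀ a b → sgn (a ℤ.+ b) ≈ sgn a * sgn b
  sgn-+ a b = begin
    sgn (a ℤ.+ b)            ≡⟨ sgn≡Sign-qz (a ℤ.+ b) ⟩
    Sign.qz (a ℤ.+ b)        ≈⟨ Sign.qz-+ a b ⟩
    Sign.qz a * Sign.qz b    ≡⟨ ≡.sym (cong₂ _*_ (sgn≡Sign-qz a) (sgn≡Sign-qz b)) ⟩
    sgn a * sgn b            ∎

  sgn[2x]≈1 : ∀ x → sgn (+ 2 ℤ.* x) ≈ 1#
  sgn[2x]≈1 x = begin
    sgn (+ 2 ℤ.* x)          ≡⟨ cong sgn 2x≡x+x ⟩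
    sgn (x ℤ.+ x)            ≈⟨ sgn-+ x x ⟩
    sgn x * sgn x            ≡⟨ cong (λ k → sgn x * pow (- 1#) k) (ℤP.∣-i∣≡∣i∣ x) ⟨
    sgn x * sgn (ℤ.- x)      ≈⟨ sgn-+ x (ℤ.- x) ⟨
    sgn (x ℤ.- x)            ≡⟨ cong sgn (ℤP.+-inverseʳ x) ⟩
    1#                       ∎
    where
    2x≡x+x : + 2 ℤ.* x ≡ x ℤ.+ x
    2x≡x+x = solve (x ∷ [])

  sgn[2x-1]≈-1 : ∀ x → sgn (+ 2 ℤ.* x ℤ.- 1ℤ) ≈ - 1#
  sgn[2x-1]≈-1 x = begin
    sgn (+ 2 ℤ.* x ℤ.- 1ℤ)       ≈⟨ sgn-+ (+ 2 ℤ.* x) -1ℤ ⟩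
    sgn (+ 2 ℤ.* x) * (- 1# * 1#) ≈⟨ *-cong (sgn[2x]≈1 x) (*-identityʳ (- 1#)) ⟩
    1# * - 1#                    ≈⟨ *-identityˡ (- 1#) ⟩
    - 1#                         ∎

  -- With these, aa n unfolds definitionally to
  -- sgn (n − 1) * qz (binom2 n) * (outer₁ (half n) + outer₂ (half (n − 1))).
  inner₁ inner₂ outer₁ outer₂ : ℤ → Carrier
  inner₁ j = sumZ (ℤ.- j ℤ.+ 1ℤ) j (λ i → qz (j ℤ.* j ℤ.- i ℤ.* i))
  inner₂ j = sumZ (ℤ.- j) j (λ i → qz (j ℤ.* j ℤ.+ j ℤ.- i ℤ.* i ℤ.- i))
  outer₁ m = sumZ 0ℤ m inner₁
  outer₂ m = sumZ 0ℤ m inner₂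

  inner₁-factor : ∀ j → inner₁ j ≈ qz (j ℤ.* j) * sumZ (ℤ.- j ℤ.+ 1ℤ) j (λ i → qz (ℤ.- (i ℤ.* i)))
  inner₁-factor j = begin
    inner₁ j
      ≈⟨ sumZ-cong (ℤ.- j ℤ.+ 1ℤ) j (λ i → qz-+ (j ℤ.* j) (ℤ.- (i ℤ.* i))) ⟩
    sumZ (ℤ.- j ℤ.+ 1ℤ) j (λ i → qz (j ℤ.* j) * qz (ℤ.- (i ℤ.* i)))
      ≈⟨ *-distribˡ-sumZ (ℤ.- j ℤ.+ 1ℤ) j (qz (j ℤ.* j)) (λ i → qz (ℤ.- (i ℤ.* i))) ⟨
    qz (j ℤ.* j) * sumZ (ℤ.- j ℤ.+ 1ℤ) j (λ i → qz (ℤ.- (i ℤ.* i)))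
      ∎

  inner₂-factor : ∀ j → inner₂ j ≈ qz (j ℤ.* j ℤ.+ j) * sumZ (ℤ.- j) j (λ i → qz (ℤ.- (i ℤ.* i) ℤ.- i))
  inner₂-factor j = begin
    inner₂ j
      ≈⟨ sumZ-cong (ℤ.- j) j (λ i → qz-+-≡ (j ℤ.* j ℤ.+ j) (ℤ.- (i ℤ.* i) ℤ.- i) (regroup j i)) ⟨
    sumZ (ℤ.- j) j (λ i → qz (j ℤ.* j ℤ.+ j) * qz (ℤ.- (i ℤ.* i) ℤ.- i))
      ≈⟨ *-distribˡ-sumZ (ℤ.- j) j (qz (j ℤ.* j ℤ.+ j)) (λ i → qz (ℤ.- (i ℤ.* i) ℤ.- i)) ⟨
    qz (j ℤ.* j ℤ.+ j) * sumZ (ℤ.- j) j (λ i → qz (ℤ.- (i ℤ.* i) ℤ.- i))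
      ∎
    where
    regroup : ∀ j i → j ℤ.* j ℤ.+ j ℤ.+ (ℤ.- (i ℤ.* i) ℤ.- i) ≡ j ℤ.* j ℤ.+ j ℤ.- i ℤ.* i ℤ.- i
    regroup = solve-∀

  aa-even : ∀ x → aa (+ 2 ℤ.* x) ≈ - (qz (x ℤ.* (+ 2 ℤ.* x ℤ.- 1ℤ)) * (outer₁ x + outer₂ (x ℤ.- 1ℤ)))
  aa-even x = begin
    sgn (y ℤ.- 1ℤ) * qz (binom2 y) * (outer₁ (half y) + outer₂ (half (y ℤ.- 1ℤ)))
      ≡⟨ cong₂ (λ e s → sgn (y ℤ.- 1ℤ) * qz e * s) (binom2[2x]≡x[2x-1] x)
               (cong₂ (λ a b → outer₁ a + outer₂ b) (half[2x]≡x x) (half[2x-1]≡x-1 x)) ⟩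
    sgn (y ℤ.- 1ℤ) * qz E * S    ≈⟨ *-congʳ (*-congʳ (sgn[2x-1]≈-1 x)) ⟩
    - 1# * qz E * S              ≈⟨ *-assoc (- 1#) (qz E) S ⟩
    - 1# * (qz E * S)            ≈⟨ -1*x≈-x (qz E * S) ⟩
    - (qz E * S)                 ∎
    where
    y = + 2 ℤ.* x
    E = x ℤ.* (+ 2 ℤ.* x ℤ.- 1ℤ)
    S = outer₁ x + outer₂ (x ℤ.- 1ℤ)

  aa-odd : ∀ x → aa (+ 2 ℤ.* x ℤ.+ 1ℤ) ≈ qz (x ℤ.* (+ 2 ℤ.* x ℤ.+ 1ℤ)) * (outer₁ x + outer₂ x)
  aa-odd x = begin
    sgn (y ℤ.- 1ℤ) * qz (binom2 y) * (outer₁ (half y) + outer₂ (half (y ℤ.- 1ℤ)))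
      ≡⟨ cong₂ (λ e s → sgn (y ℤ.- 1ℤ) * qz e * s) (binom2[2x+1]≡x[2x+1] x)
               (cong₂ (λ a b → outer₁ a + outer₂ b) (half[2x+1]≡x x)
                      (≡.trans (cong half y-1≡2x) (half[2x]≡x x))) ⟩
    sgn (y ℤ.- 1ℤ) * qz E * S    ≡⟨ cong (λ k → sgn k * qz E * S) y-1≡2x ⟩
    sgn (+ 2 ℤ.* x) * qz E * S   ≈⟨ *-congʳ (*-congʳ (sgn[2x]≈1 x)) ⟩
    1# * qz E * S                ≈⟨ *-congʳ (*-identityˡ (qz E)) ⟩
    qz E * S                     ∎
    where
    y = + 2 ℤ.* x ℤ.+ 1ℤ
    E = x ℤ.* (+ 2 ℤ.* x ℤ.+ 1ℤ)
    S = outer₁ x + outer₂ x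
    y-1≡2x : + 2 ℤ.* x ℤ.+ 1ℤ ℤ.- 1ℤ ≡ + 2 ℤ.* x
    y-1≡2x = solve (x ∷ [])

  -- Both outer sums are empty at −1.
  aa[-1]≈0 : aa -1ℤ ≈ 0#
  aa[-1]≈0 = trans (*-congˡ (+-identityʳ 0#)) (zeroʳ _)

  aa1[2n]-last-row : ∀ n → aa1 (+ (2 ℕ.* n)) ≈ - (qz (+ n ℤ.* (+ 2 ℤ.* + n ℤ.- 1ℤ)) * inner₁ (+ n))
  aa1[2n]-last-row n = begin
    aa1 (+ (2 ℕ.* n))
      ≡⟨ cong aa1 (ℤP.pos-* 2 n) ⟩
    aa (+ 2 ℤ.* x) + qz (+ 2 ℤ.* x ℤ.- 1ℤ) * aa (+ 2 ℤ.* x ℤ.- 1ℤ)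
      ≡⟨ cong (λ t → aa (+ 2 ℤ.* x) + qz (+ 2 ℤ.* x ℤ.- 1ℤ) * aa t) (2x-1≡2[x-1]+1 x) ⟩
    aa (+ 2 ℤ.* x) + qz (+ 2 ℤ.* x ℤ.- 1ℤ) * aa (+ 2 ℤ.* (x ℤ.- 1ℤ) ℤ.+ 1ℤ)
      ≈⟨ +-cong (aa-even x) (*-congˡ (aa-odd (x ℤ.- 1ℤ))) ⟩
    - (qz E * (outer₁ x + O₂)) + qz (+ 2 ℤ.* x ℤ.- 1ℤ) * (qz E′ * (O₁ + O₂))
      ≈⟨ +-cong (-‿cong (*-congˡ (+-congʳ (sumZ-snoc 0ℤ n inner₁))))
                (qz-merge (+ 2 ℤ.* x ℤ.- 1ℤ) E′ (exponent x) (O₁ + O₂)) ⟩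
    - (qz E * ((O₁ + inner₁ x) + O₂)) + qz E * (O₁ + O₂)
      ≈⟨ +-congʳ (-‿cong (*-congˡ (xy∙z≈xz∙y O₁ (inner₁ x) O₂))) ⟩
    - (qz E * ((O₁ + O₂) + inner₁ x)) + qz E * (O₁ + O₂)
      ≈⟨ +-congʳ (-‿cong (distribˡ (qz E) (O₁ + O₂) (inner₁ x))) ⟩
    - (qz E * (O₁ + O₂) + qz E * inner₁ x) + qz E * (O₁ + O₂)
      ≈⟨ -[x+y]+x≈-y (qz E * (O₁ + O₂)) (qz E * inner₁ x) ⟩
    - (qz E * inner₁ x)
      ∎
    where
    x = + n
    E = x ℤ.* (+ 2 ℤ.* x ℤ.- 1ℤ)
    E′ = (x ℤ.- 1ℤ) ℤ.* (+ 2 ℤ.* (x ℤ.- 1ℤ) ℤ.+ 1ℤ)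
    O₁ = outer₁ (x ℤ.- 1ℤ)
    O₂ = outer₂ (x ℤ.- 1ℤ)
    2x-1≡2[x-1]+1 : ∀ x → + 2 ℤ.* x ℤ.- 1ℤ ≡ + 2 ℤ.* (x ℤ.- 1ℤ) ℤ.+ 1ℤ
    2x-1≡2[x-1]+1 = solve-∀
    exponent : ∀ x →
      + 2 ℤ.* x ℤ.- 1ℤ ℤ.+ (x ℤ.- 1ℤ) ℤ.* (+ 2 ℤ.* (x ℤ.- 1ℤ) ℤ.+ 1ℤ) ≡ x ℤ.* (+ 2 ℤ.* x ℤ.- 1ℤ)
    exponent = solve-∀

  aa1[2n] : ∀ n → aa1 (+ (2 ℕ.* n)) ≈
    - (qz (+ 3 ℤ.* + n ℤ.* + n ℤ.- + n) * sumZ (ℤ.- + n ℤ.+ 1ℤ) (+ n) (λ j → qz (ℤ.- (j ℤ.* j))))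
  aa1[2n] n = begin
    aa1 (+ (2 ℕ.* n))                   ≈⟨ aa1[2n]-last-row n ⟩
    - (qz E * inner₁ x)                 ≈⟨ -‿cong (*-congˡ (inner₁-factor x)) ⟩
    - (qz E * (qz (x ℤ.* x) * S))       ≈⟨ -‿cong (qz-merge E (x ℤ.* x) (exponent x) S) ⟩
    - (qz (+ 3 ℤ.* x ℤ.* x ℤ.- x) * S)  ∎
    where
    x = + n
    E = x ℤ.* (+ 2 ℤ.* x ℤ.- 1ℤ)
    S = sumZ (ℤ.- x ℤ.+ 1ℤ) x (λ j → qz (ℤ.- (j ℤ.* j)))
    exponent : ∀ x → x ℤ.* (+ 2 ℤ.* x ℤ.- 1ℤ) ℤ.+ x ℤ.* x ≡ + 3 ℤ.* x ℤ.* x ℤ.- x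
    exponent = solve-∀

  aa1[2n+1]-last-row : ∀ n → aa1 (+ (2 ℕ.* n ℕ.+ 1)) ≈ qz (+ n ℤ.* (+ 2 ℤ.* + n ℤ.+ 1ℤ)) * inner₂ (+ n)
  aa1[2n+1]-last-row n = begin
    aa1 (+ (2 ℕ.* n ℕ.+ 1))
      ≡⟨ cong aa1 (≡.trans (ℤP.pos-+ (2 ℕ.* n) 1) (cong (ℤ._+ 1ℤ) (ℤP.pos-* 2 n))) ⟩
    aa (y ℤ.+ 1ℤ) + qz (y ℤ.+ 1ℤ ℤ.- 1ℤ) * aa (y ℤ.+ 1ℤ ℤ.- 1ℤ)
      ≡⟨ cong (λ t → aa (y ℤ.+ 1ℤ) + qz (y ℤ.+ 1ℤ ℤ.- 1ℤ) * aa t) (y+1-1≡y y) ⟩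
    aa (y ℤ.+ 1ℤ) + qz (y ℤ.+ 1ℤ ℤ.- 1ℤ) * aa y
      ≈⟨ +-cong (aa-odd x) (*-congˡ (aa-even x)) ⟩
    qz E′ * (O₁ + outer₂ x) + qz (y ℤ.+ 1ℤ ℤ.- 1ℤ) * - (qz E * (O₁ + O₂))
      ≈⟨ +-cong (*-congˡ (+-congˡ (sumZ-snoc 0ℤ n inner₂)))
                (sym (-‿distribʳ-* (qz (y ℤ.+ 1ℤ ℤ.- 1ℤ)) (qz E * (O₁ + O₂)))) ⟩
    qz E′ * (O₁ + (O₂ + inner₂ x)) + - (qz (y ℤ.+ 1ℤ ℤ.- 1ℤ) * (qz E * (O₁ + O₂)))
      ≈⟨ +-cong (*-congˡ (sym (+-assoc O₁ O₂ (inner₂ x))))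
                (-‿cong (qz-merge (y ℤ.+ 1ℤ ℤ.- 1ℤ) E (exponent x) (O₁ + O₂))) ⟩
    qz E′ * ((O₁ + O₂) + inner₂ x) + - (qz E′ * (O₁ + O₂))
      ≈⟨ +-congʳ (distribˡ (qz E′) (O₁ + O₂) (inner₂ x)) ⟩
    qz E′ * (O₁ + O₂) + qz E′ * inner₂ x + - (qz E′ * (O₁ + O₂))
      ≈⟨ xyx⁻¹≈y (qz E′ * (O₁ + O₂)) (qz E′ * inner₂ x) ⟩
    qz E′ * inner₂ x
      ∎
    where
    x = + n
    y = + 2 ℤ.* x
    E = x ℤ.* (+ 2 ℤ.* x ℤ.- 1ℤ)
    E′ = x ℤ.* (+ 2 ℤ.* x ℤ.+ 1ℤ)
    O₁ = outer₁ x
    O₂ = outer₂ (x ℤ.- 1ℤ)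
    y+1-1≡y : ∀ y → y ℤ.+ 1ℤ ℤ.- 1ℤ ≡ y
    y+1-1≡y = solve-∀
    exponent : ∀ x →
      + 2 ℤ.* x ℤ.+ 1ℤ ℤ.- 1ℤ ℤ.+ x ℤ.* (+ 2 ℤ.* x ℤ.- 1ℤ) ≡ x ℤ.* (+ 2 ℤ.* x ℤ.+ 1ℤ)
    exponent = solve-∀

  aa1[2n+1] : ∀ n → aa1 (+ (2 ℕ.* n ℕ.+ 1)) ≈
    qz (+ 3 ℤ.* + n ℤ.* + n ℤ.+ + 2 ℤ.* + n) * sumZ (ℤ.- + n) (+ n) (λ j → qz (ℤ.- (j ℤ.* j) ℤ.- j))
  aa1[2n+1] n = begin
    aa1 (+ (2 ℕ.* n ℕ.+ 1))                 ≈⟨ aa1[2n+1]-last-row n ⟩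
    qz E * inner₂ x                          ≈⟨ *-congˡ (inner₂-factor x) ⟩
    qz E * (qz (x ℤ.* x ℤ.+ x) * S)          ≈⟨ qz-merge E (x ℤ.* x ℤ.+ x) (exponent x) S ⟩
    qz (+ 3 ℤ.* x ℤ.* x ℤ.+ + 2 ℤ.* x) * S   ∎
    where
    x = + n
    E = x ℤ.* (+ 2 ℤ.* x ℤ.+ 1ℤ)
    S = sumZ (ℤ.- x) x (λ j → qz (ℤ.- (j ℤ.* j) ℤ.- j))
    exponent : ∀ x → x ℤ.* (+ 2 ℤ.* x ℤ.+ 1ℤ) ℤ.+ (x ℤ.* x ℤ.+ x) ≡ + 3 ℤ.* x ℤ.* x ℤ.+ + 2 ℤ.* x
    exponent = solve-∀

  expansion-coeff : ℤ → ℕ → Carrier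
  expansion-coeff N k = sgn (+ k) * qz (N ℤ.* + k ℤ.- binom2 (+ k ℤ.+ 1ℤ))

  expansion-coeff-suc : ∀ N k → expansion-coeff N k * qz (N ℤ.- + k ℤ.- 1ℤ) ≈ - expansion-coeff N (suc k)
  expansion-coeff-suc N k = begin
    s * qz Y * qz Z                ≈⟨ *-assoc s (qz Y) (qz Z) ⟩
    s * (qz Y * qz Z)              ≈⟨ *-congˡ (qz-+-≡ Y Z (expansion-exponent-suc N (+ k))) ⟩
    s * qz Y′                      ≈⟨ -‿involutive (s * qz Y′) ⟨
    - - (s * qz Y′)                ≈⟨ -‿cong (-1*x≈-x (s * qz Y′)) ⟨
    - (- 1# * (s * qz Y′))         ≈⟨ -‿cong (*-assoc (- 1#) s (qz Y′)) ⟨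
    - (- 1# * s * qz Y′)           ∎
    where
    s = sgn (+ k)
    Y = N ℤ.* + k ℤ.- binom2 (+ k ℤ.+ 1ℤ)
    Z = N ℤ.- + k ℤ.- 1ℤ
    Y′ = N ℤ.* + suc k ℤ.- binom2 (+ suc k ℤ.+ 1ℤ)

  expansion-term : ℤ → ℕ → Carrier
  expansion-term N k = expansion-coeff N k * aa (N ℤ.- + k)

  expansion-summand-telescopes : ∀ N k →
    expansion-coeff N k * aa1 (N ℤ.- + k) ≈ expansion-term N k - expansion-term N (suc k)
  expansion-summand-telescopes N k = begin
    cₖ * (aa (N ℤ.- + k) + qz Z * aa Z)
      ≈⟨ distribˡ cₖ (aa (N ℤ.- + k)) (qz Z * aa Z) ⟩
    expansion-term N k + cₖ * (qz Z * aa Z)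
      ≈⟨ +-congˡ (*-assoc cₖ (qz Z) (aa Z)) ⟨
    expansion-term N k + cₖ * qz Z * aa Z
      ≈⟨ +-congˡ (*-cong (expansion-coeff-suc N k) (reflexive (cong aa (N-k-1≡N-[1+k] N (+ k))))) ⟩
    expansion-term N k + - cₖ₊₁ * aa (N ℤ.- + suc k)
      ≈⟨ +-congˡ (-‿distribˡ-* cₖ₊₁ (aa (N ℤ.- + suc k))) ⟨
    expansion-term N k - expansion-term N (suc k)
      ∎
    where
    cₖ = expansion-coeff N k
    cₖ₊₁ = expansion-coeff N (suc k)
    Z = N ℤ.- + k ℤ.- 1ℤ
    N-k-1≡N-[1+k] : ∀ N k → N ℤ.- k ℤ.- 1ℤ ≡ N ℤ.- (1ℤ ℤ.+ k)
    N-k-1≡N-[1+k] = solve-∀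

  aa-expansion : ∀ n → aa (+ n) ≈
    sumZ 0ℤ (+ n) (λ j → sgn j * qz (+ n ℤ.* j ℤ.- binom2 (j ℤ.+ 1ℤ)) * aa1 (+ n ℤ.- j))
  aa-expansion n = sym (begin
    sumZ 0ℤ N F                          ≡⟨ sumZ-from-0 n F ⟩
    sumN (suc n) (λ k → F (+ k))         ≈⟨ sumN-cong (suc n) (expansion-summand-telescopes N) ⟩
    sumN (suc n) (λ k → d k - d (suc k)) ≈⟨ sumN-telescope (suc n) d ⟩
    d 0 - d (suc n)                      ≈⟨ +-cong first-term (-‿cong last-term) ⟩
    aa N - 0#                            ≈⟨ +-congˡ -0#≈0# ⟩
    aa N + 0#                            ≈⟨ +-identityʳ (aa N) ⟩
    aa N                                 ∎)
    where
    N = + n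
    F : ℤ → Carrier
    F j = sgn j * qz (N ℤ.* j ℤ.- binom2 (j ℤ.+ 1ℤ)) * aa1 (N ℤ.- j)
    d : ℕ → Carrier
    d = expansion-term N
    first-term : d 0 ≈ aa N
    first-term = begin
      1# * qz (N ℤ.* + 0 ℤ.- + 0) * aa (N ℤ.- + 0)
        ≡⟨ cong₂ (λ e a → 1# * qz e * aa a) (cong (ℤ._- + 0) (ℤP.*-zeroʳ N)) (ℤP.+-identityʳ N) ⟩
      1# * 1# * aa N    ≈⟨ *-congʳ (*-identityˡ 1#) ⟩
      1# * aa N         ≈⟨ *-identityˡ (aa N) ⟩
      aa N              ∎
    last-term : d (suc n) ≈ 0#
    last-term = begin
      expansion-coeff N (suc n) * aa (N ℤ.- + suc n)
        ≡⟨ cong (λ t → expansion-coeff N (suc n) * aa t) (x-[1+x]≡-1 N) ⟩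
      expansion-coeff N (suc n) * aa -1ℤ   ≈⟨ *-congˡ aa[-1]≈0 ⟩
      expansion-coeff N (suc n) * 0#       ≈⟨ zeroʳ _ ⟩
      0#                                   ∎
      where
      x-[1+x]≡-1 : ∀ x → x ℤ.- (1ℤ ℤ.+ x) ≡ -1ℤ
      x-[1+x]≡-1 = solve-∀

corollary4p3 : ∀ {c ℓ} (R : CommutativeRing c ℓ) (q q⁻ : CommutativeRing.Carrier R) →
    CommutativeRing._≈_ R (CommutativeRing._*_ R q q⁻) (CommutativeRing.1# R) →
    let open CommutativeRing R
        open Q R q q⁻
    in (∀ (n : ℕ) → aa1 (+ (2 ℕ.* n)) ≈
          - (qz (ℤ.+ 3 ℤ.* + n ℤ.* + n ℤ.- + n) *
             sumZ (ℤ.- + n ℤ.+ ℤ.1ℤ) (+ n) (λ j → qz (ℤ.- (j ℤ.* j)))))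
     × (∀ (n : ℕ) → aa1 (+ (2 ℕ.* n ℕ.+ 1)) ≈
          qz (ℤ.+ 3 ℤ.* + n ℤ.* + n ℤ.+ ℤ.+ 2 ℤ.* + n) *
             sumZ (ℤ.- + n) (+ n) (λ j → qz (ℤ.- (j ℤ.* j) ℤ.- j)))
     × (∀ (n : ℕ) → aa (+ n) ≈
          sumZ ℤ.0ℤ (+ n) (λ j →
            sgn j * qz (+ n ℤ.* j ℤ.- binom2 (j ℤ.+ ℤ.1ℤ)) * aa1 (+ n ℤ.- j)))
corollary4p3 R q q⁻ q*q⁻≈1 = aa1[2n] , aa1[2n+1] , aa-expansion
  where open Proof R q q⁻ q*q⁻≈1
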